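{- For every $n\ge0$, the sum of all terms of Stern's triatomic sequence at level $n$ equals $3\cdot 5^n$; that is, $$\sum_{J}\sum_{k=1}^{3} v_k(J)=3\cdot 5^n,$$ where $J$ ranges over all $n$-tuples $(j_1,\dots,j_n)$ with each $j_i\in\{0,1,2\}$.
   Context: Let $A_0=\begin{pmatrix}1&0&1\\0&1&1\\0&0&1\end{pmatrix}$, $A_1=\begin{pmatrix}0&0&1\\1&0&1\\0&1&1\end{pmatrix}$, $A_2=\begin{pmatrix}0&1&1\\0&0&1\\1&0&1\end{pmatrix}$. For a tuple $J=(j_1,\dots,j_n)$ with $j_i\in\{0,1,2\}$ ($n\ge0$) set $(v_1(J),v_2(J),v_3(J))=(1,1,1)A_{j_1}\cdots A_{j_n}$. The numbers $v_k(J)$, $k=1,2,3$, with $J$ of length $n$ are the terms of Stern's triatomic sequence at level $n$. -}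

module Defs where

open import Data.Nat using (ℕ; zero; suc; _+_; _*_; _^_)
open import Data.Fin using (Fin; zero; suc)
open import Data.Vec using (Vec; []; _∷_)
open import Data.List using (List; []; _∷_; map; concatMap)

Mat : Set
Mat = Fin 3 → Fin 3 → ℕ

RowVec : Set
RowVec = Fin 3 → ℕ

mat : ℕ → ℕ → ℕ → ℕ → ℕ → ℕ → ℕ → ℕ → ℕ → Mat
mat a b c d e f g h i zero zero = a
mat a b c d e f g h i zero (suc zero) = b
mat a b c d e f g h i zero (suc (suc zero)) = c
mat a b c d e f g h i (suc zero) zero = d
mat a b c d e f g h i (suc zero) (suc zero) = e
mat a b c d e f g h i (suc zero) (suc (suc zero)) = f
mat a b c d e f g h i (suc (suc zero)) zero = g
mat a b c d e f g h i (suc (suc zero)) (suc zero) = h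
mat a b c d e f g h i (suc (suc zero)) (suc (suc zero)) = i

A : Fin 3 → Mat
A zero             = mat 1 0 1  0 1 1  0 0 1
A (suc zero)       = mat 0 0 1  1 0 1  0 1 1
A (suc (suc zero)) = mat 0 1 1  0 0 1  1 0 1

_·_ : RowVec → Mat → RowVec
(v · M) k = v zero * M zero k + v (suc zero) * M (suc zero) k + v (suc (suc zero)) * M (suc (suc zero)) k

-- (v₁(J), v₂(J), v₃(J)) = (1,1,1) A_{j₁} ⋯ A_{jₙ}  (multiplied left to right)
vecAux : RowVec → {n : ℕ} → Vec (Fin 3) n → RowVec
vecAux v []      = v
vecAux v (j ∷ J) = vecAux (v · A j) J

v : {n : ℕ} → Vec (Fin 3) n → RowVec
v J = vecAux (λ _ → 1) J

allFin3 : List (Fin 3)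
allFin3 = zero ∷ suc zero ∷ suc (suc zero) ∷ []

tuples : (n : ℕ) → List (Vec (Fin 3) n)
tuples zero    = [] ∷ []
tuples (suc n) = concatMap (λ j → map (j ∷_) (tuples n)) allFin3

termSum : {n : ℕ} → Vec (Fin 3) n → ℕ
termSum J = v J zero + v J (suc zero) + v J (suc (suc zero))

-- Summing the entries of a row vector is linear, and since every row of A₀ + A₁ + A₂ sums to 5,
-- the entry sums of w A₀, w A₁, w A₂ add up to 5 times the entry sum of w.  Splitting the tuples of
-- length n + 1 by their first letter j, the level-(n + 1) sum started at w is the sum over j of the
-- level-n sums started at w Aⱼ, so by induction it equals 5ⁿ times the entry sum of w.
module Submission where

open import Defs
open import Data.Nat using (ℕ; zero; suc; _+_; _*_; _^_)
open import Data.Nat.Properties using (*-comm; *-assoc; *-zeroʳ; *-distribˡ-+)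
open import Data.Nat.Tactic.RingSolver using (solve-∀)
open import Data.Fin using (Fin; zero; suc)
import Data.Vec as Vec
open import Data.List using (List; []; _∷_; _++_; map; concatMap)
open import Data.List.Properties using (map-++; map-∘; map-cong)
open import Data.Nat.ListAction using (sum)
open import Data.Nat.ListAction.Properties using (sum-++)
open import Function using (_∘_)
open import Relation.Binary.PropositionalEquality using (_≡_; refl; sym; cong; module ≡-Reasoning)

sum-map-concatMap : ∀ {a b} {X : Set a} {Y : Set b} (f : Y → ℕ) (g : X → List Y) (xs : List X) →
                    sum (map f (concatMap g xs)) ≡ sum (map (λ x → sum (map f (g x))) xs)
sum-map-concatMap f g []       = refl
sum-map-concatMap f g (x ∷ xs) = begin
  sum (map f (g x ++ concatMap g xs))                          ≡⟨ cong sum (map-++ f (g x) _) ⟩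
  sum (map f (g x) ++ map f (concatMap g xs))                  ≡⟨ sum-++ (map f (g x)) _ ⟩
  sum (map f (g x)) + sum (map f (concatMap g xs))             ≡⟨ cong (sum (map f (g x)) +_) (sum-map-concatMap f g xs) ⟩
  sum (map f (g x)) + sum (map (λ y → sum (map f (g y))) xs)   ∎
  where open ≡-Reasoning

sum-map-*ˡ : ∀ {a} {X : Set a} (k : ℕ) (f : X → ℕ) (xs : List X) →
             sum (map (λ x → k * f x) xs) ≡ k * sum (map f xs)
sum-map-*ˡ k f []       = sym (*-zeroʳ k)
sum-map-*ˡ k f (x ∷ xs) = begin
  k * f x + sum (map (λ y → k * f y) xs)   ≡⟨ cong (k * f x +_) (sum-map-*ˡ k f xs) ⟩
  k * f x + k * sum (map f xs)             ≡⟨ sym (*-distribˡ-+ k (f x) _) ⟩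
  k * (f x + sum (map f xs))               ∎
  where open ≡-Reasoning

total : RowVec → ℕ
total w = w zero + w (suc zero) + w (suc (suc zero))

sum-total-·-generators : ∀ w → sum (map (λ j → total (w · A j)) allFin3) ≡ 5 * total w
sum-total-·-generators w = expanded (w zero) (w (suc zero)) (w (suc (suc zero)))
  where
  expanded : ∀ a b c →
    (a * 1 + b * 0 + c * 0) + (a * 0 + b * 1 + c * 0) + (a * 1 + b * 1 + c * 1)
    + ((a * 0 + b * 1 + c * 0) + (a * 0 + b * 0 + c * 1) + (a * 1 + b * 1 + c * 1)
    + ((a * 0 + b * 0 + c * 1) + (a * 1 + b * 0 + c * 0) + (a * 1 + b * 1 + c * 1) + 0))
    ≡ 5 * (a + b + c)
  expanded = solve-∀

levelSum : ℕ → RowVec → ℕ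
levelSum n w = sum (map (total ∘ vecAux w) (tuples n))

levelSum-suc : ∀ n w → levelSum (suc n) w ≡ sum (map (λ j → levelSum n (w · A j)) allFin3)
levelSum-suc n w = begin
  sum (map (total ∘ vecAux w) (concatMap (λ j → map (j Vec.∷_) (tuples n)) allFin3))
    ≡⟨ sum-map-concatMap (total ∘ vecAux w) (λ j → map (j Vec.∷_) (tuples n)) allFin3 ⟩
  sum (map (λ j → sum (map (total ∘ vecAux w) (map (j Vec.∷_) (tuples n)))) allFin3)
    ≡⟨ cong sum (map-cong (λ j → cong sum (sym (map-∘ {g = total ∘ vecAux w} {f = j Vec.∷_} (tuples n)))) allFin3) ⟩
  sum (map (λ j → levelSum n (w · A j)) allFin3) ∎
  where open ≡-Reasoning

levelSum-closed : ∀ n w → levelSum n w ≡ 5 ^ n * total w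
levelSum-closed zero    w = refl
levelSum-closed (suc n) w = begin
  levelSum (suc n) w                                         ≡⟨ levelSum-suc n w ⟩
  sum (map (λ j → levelSum n (w · A j)) allFin3)             ≡⟨ cong sum (map-cong (λ j → levelSum-closed n (w · A j)) allFin3) ⟩
  sum (map (λ j → 5 ^ n * total (w · A j)) allFin3)          ≡⟨ sum-map-*ˡ (5 ^ n) (λ j → total (w · A j)) allFin3 ⟩
  5 ^ n * sum (map (λ j → total (w · A j)) allFin3)          ≡⟨ cong (5 ^ n *_) (sum-total-·-generators w) ⟩
  5 ^ n * (5 * total w)                                      ≡⟨ sym (*-assoc (5 ^ n) 5 (total w)) ⟩
  5 ^ n * 5 * total w                                        ≡⟨ cong (_* total w) (*-comm (5 ^ n) 5) ⟩
  5 ^ suc n * total w                                        ∎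
  where open ≡-Reasoning

mainTheorem6 : (n : ℕ) → sum (map termSum (tuples n)) ≡ 3 * 5 ^ n
mainTheorem6 n = begin
  levelSum n (λ _ → 1)   ≡⟨ levelSum-closed n (λ _ → 1) ⟩
  5 ^ n * 3              ≡⟨ *-comm (5 ^ n) 3 ⟩
  3 * 5 ^ n              ∎
  where open ≡-Reasoning
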